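{- (i) Every non-extensible combinatorial torus cube packing of dimension $n$ has at least $n+1$ cubes. (ii) If $\mathcal{CP}$ is a combinatorial torus cube tiling of dimension $n$, then for every coordinate $j$ and every parameter $t$, the number of cubes $z+[0,1]^n$ of $\mathcal{CP}$ with $z_j=t$ equals the number with $z_j=t+1$.
   Context: A combinatorial torus cube in dimension $n$ is a formal cube $z+[0,1]^n$, $z=(z_1,\dots,z_n)$, with each $z_j$ equal to $t$ or $t+1$ for a formal parameter $t$, parameters in different coordinates being distinct. Two such cubes are non-overlapping if for some coordinate $j$, $z_j,z'_j$ involve the same parameter $t$ and $\{z_j,z'_j\}=\{t,t+1\}$. A combinatorial torus cube packing is a finite family of pairwise non-overlapping such cubes; it is a tiling if it has $2^n$ cubes. It is non-extensible if it has fewer than $2^n$ cubes and no combinatorial torus cube (using old or new parameters) can be added keeping non-overlap. -}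

module Defs where

open import Data.Nat using (ℕ; zero; suc; _+_; _^_; _<_; _≟_)
open import Data.Bool using (Bool; true; false)
open import Data.Fin using (Fin)
open import Data.Product using (_×_; _,_; proj₁; proj₂; ∃; ∃-syntax)
open import Data.List using (List; []; _∷_; length)
open import Data.List.Relation.Unary.All using (All)
open import Data.List.Relation.Unary.AllPairs using (AllPairs)
open import Relation.Binary.PropositionalEquality using (_≡_; _≢_)
open import Relation.Nullary using (¬_; yes; no)

-- An entry z_j of a combinatorial torus cube: a parameter name t (a natural number)
-- together with a Bool: false means z_j = t, true means z_j = t + 1.
-- Parameters are named per coordinate: the parameter (j , t) used in coordinate j
-- is never the same as a parameter used in another coordinate, which encodes
-- "parameters in different coordinates being distinct".
Entry : Set
Entry = ℕ × Bool

-- A combinatorial torus cube z + [0,1]^n, represented by z.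
Cube : ℕ → Set
Cube n = Fin n → Entry

NonOverlap : ∀ {n} → Cube n → Cube n → Set
NonOverlap {n} z z′ = ∃[ j ] (proj₁ (z j) ≡ proj₁ (z′ j) × proj₂ (z j) ≢ proj₂ (z′ j))

IsPacking : ∀ {n} → List (Cube n) → Set
IsPacking = AllPairs NonOverlap

IsTiling : ∀ n → List (Cube n) → Set
IsTiling n P = IsPacking P × length P ≡ 2 ^ n

-- Non-extensible: a packing with fewer than 2^n cubes to which no cube
-- (with arbitrary, old or new, parameters) can be added keeping non-overlap.
IsNonExtensible : ∀ n → List (Cube n) → Set
IsNonExtensible n P =
  IsPacking P × length P < 2 ^ n × ¬ (∃[ c ] All (NonOverlap c) P)

countEntry : ∀ {n} → Fin n → ℕ → Bool → List (Cube n) → ℕ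
countEntry j t b [] = 0
countEntry j t b (z ∷ P) with proj₁ (z j) ≟ t | proj₂ (z j) Data.Bool.≟ b
... | yes _ | yes _ = suc (countEntry j t b P)
... | _     | _     = countEntry j t b P

module Submission where

-- A list of at most n cubes can always be escaped: the i-th cube of
-- the list is avoided by a new cube whose i-th coordinate is the "opposite"
-- entry (same parameter, other half).
--
-- A valuation σ chooses, for every parameter t, one of the two
-- entries t, t+1; a cube "contains" σ in coordinate j when its j-th entry is
-- the chosen one.  The σ-slice of a packing at coordinate j keeps the cubes
-- containing σ and deletes coordinate j; it is again a packing (two such cubes
-- cannot be separated at j), and the σ-slice and the (not ∘ σ)-slice split the
-- packing.  By induction this bounds every packing of dimension n by 2^n, and
-- forces every slice of a tiling to have exactly 2^(n-1) cubes.  Changing σ at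
-- the single parameter t from t to t+1 trades the cubes with z_j = t for those
-- with z_j = t+1, so both numbers must agree.

open import Defs
open import Data.Nat using (ℕ; zero; suc; _+_; _^_; _≤_; _≟_; _≤?_; z≤n; s≤s)
open import Data.Nat.Properties
  using (+-suc; +-comm; +-identityʳ; +-mono-≤; +-monoʳ-≤; +-cancelʳ-≤; +-cancelˡ-≡;
         ≤-antisym; ≰⇒>; module ≤-Reasoning)
open import Data.Bool using (Bool; true; false; not; if_then_else_) renaming (_≟_ to _≟ᴮ_)
open import Data.Bool.Properties using (not-¬; ¬-not; not-injective)
open import Data.Fin using (Fin; zero; suc; punchIn; punchOut)
open import Data.Fin.Properties using (punchIn-punchOut) renaming (_≟_ to _≟ᶠ_)
open import Data.Vec.Functional using (tail) renaming (_∷_ to _◂_)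
open import Data.Product using (_×_; _,_; proj₁; proj₂; ∃-syntax)
open import Data.List using (List; []; _∷_; length; map)
open import Data.List.Properties using (length-map)
open import Data.List.Relation.Unary.All using (All; []; _∷_)
import Data.List.Relation.Unary.All as All
open import Data.List.Relation.Unary.All.Properties using (map⁻)
open import Data.List.Relation.Unary.AllPairs using ([]; _∷_)
open import Relation.Binary.PropositionalEquality
  using (_≡_; _≢_; refl; sym; trans; cong; subst; module ≡-Reasoning)
open import Relation.Nullary using (¬_; yes; no)
open import Data.Empty using (⊥-elim)

SeparatedAt : ∀ {n} → Fin n → Cube n → Cube n → Set
SeparatedAt j p q = proj₁ (p j) ≡ proj₁ (q j) × proj₂ (p j) ≢ proj₂ (q j)

opposite : Entry → Entry
opposite (t , b) = t , not b

opposite-separates : ∀ {n} (c : Cube n) (q : Cube (suc n)) →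
  NonOverlap (opposite (q zero) ◂ c) q
opposite-separates c q = zero , refl , λ flipped → not-¬ refl (sym flipped)

prefix-keeps-separation : ∀ {n} (e : Entry) (c : Cube n) (q : Cube (suc n)) →
  NonOverlap c (tail q) → NonOverlap (e ◂ c) q
prefix-keeps-separation e c q (k , sep) = suc k , sep

escape : ∀ n (Q : List (Cube n)) → length Q ≤ n → ∃[ c ] All (NonOverlap c) Q
escape n       []      _           = (λ _ → 0 , false) , []
escape (suc n) (q ∷ Q) (s≤s |Q|≤n) with escape n (map tail Q) |tailQ|≤n
  where
  |tailQ|≤n : length (map tail Q) ≤ n
  |tailQ|≤n = subst (_≤ n) (sym (length-map tail Q)) |Q|≤n
... | c , avoids =
  opposite (q zero) ◂ c ,
  opposite-separates c q ∷ All.map (prefix-keeps-separation _ c _) (map⁻ avoids)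

nonExtensible-size : (n : ℕ) (P : List (Cube n)) → IsNonExtensible n P → n + 1 ≤ length P
nonExtensible-size n P (_ , _ , maximal) with length P ≤? n
... | yes |P|≤n = ⊥-elim (maximal (escape n P |P|≤n))
... | no  |P|≰n = subst (_≤ length P) (+-comm 1 n) (≰⇒> |P|≰n)

-- A choice of one half for every parameter: σ t = b chooses the entry
-- t (b = false) or t+1 (b = true).
Valuation : Set
Valuation = ℕ → Bool

_≡ᵇ_ : Bool → Bool → Bool
true  ≡ᵇ b = b
false ≡ᵇ b = not b

contains : Valuation → Entry → Bool
contains σ (t , b) = σ t ≡ᵇ b

≡ᵇ-unique : ∀ a {b b′} → (a ≡ᵇ b) ≡ true → (a ≡ᵇ b′) ≡ true → b ≡ b′
≡ᵇ-unique true  b≡true   b′≡true   = trans b≡true (sym b′≡true)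
≡ᵇ-unique false ¬b≡true ¬b′≡true = not-injective (trans ¬b≡true (sym ¬b′≡true))

contains-unseparated : ∀ {n} σ (j : Fin n) {p q : Cube n} →
  contains σ (p j) ≡ true → contains σ (q j) ≡ true → ¬ SeparatedAt j p q
contains-unseparated σ j {p} {q} σ∈p σ∈q (same , differ) with p j | q j | same
... | t , b | .t , b′ | refl = differ (≡ᵇ-unique (σ t) σ∈p σ∈q)

delete : ∀ {m} → Fin (suc m) → Cube (suc m) → Cube m
delete j z k = z (punchIn j k)

delete-keeps-separation : ∀ {m} (j : Fin (suc m)) {p q : Cube (suc m)} →
  NonOverlap p q → ¬ SeparatedAt j p q → NonOverlap (delete j p) (delete j q)
delete-keeps-separation j {p} {q} (i , sep) notAtj with j ≟ᶠ i
... | yes refl = ⊥-elim (notAtj sep)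
... | no  j≢i  = punchOut j≢i , subst (λ k → SeparatedAt k p q) (sym (punchIn-punchOut j≢i)) sep

slice : ∀ {m} → Valuation → Fin (suc m) → List (Cube (suc m)) → List (Cube m)
slice σ j []      = []
slice σ j (z ∷ P) = if contains σ (z j) then delete j z ∷ slice σ j P else slice σ j P

slice-avoids : ∀ {m} σ (j : Fin (suc m)) p (P : List (Cube (suc m))) →
  contains σ (p j) ≡ true → All (NonOverlap p) P → All (NonOverlap (delete j p)) (slice σ j P)
slice-avoids σ j p []      σ∈p []             = []
slice-avoids σ j p (q ∷ P) σ∈p (p#q ∷ p#P) with contains σ (q j) in σ∈q
... | true  = delete-keeps-separation j p#q (contains-unseparated σ j {p} {q} σ∈p σ∈q)
              ∷ slice-avoids σ j p P σ∈p p#P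
... | false = slice-avoids σ j p P σ∈p p#P

slice-packing : ∀ {m} σ (j : Fin (suc m)) (P : List (Cube (suc m))) →
  IsPacking P → IsPacking (slice σ j P)
slice-packing σ j []      []              = []
slice-packing σ j (p ∷ P) (p#P ∷ packing) with contains σ (p j) in σ∈p
... | true  = slice-avoids σ j p P σ∈p p#P ∷ slice-packing σ j P packing
... | false = slice-packing σ j P packing

slice-split : ∀ {m} σ (j : Fin (suc m)) (P : List (Cube (suc m))) →
  length (slice σ j P) + length (slice (λ s → not (σ s)) j P) ≡ length P
slice-split σ j []      = refl
slice-split σ j (p ∷ P) with σ (proj₁ (p j)) | proj₂ (p j)
... | true  | true  = cong suc (slice-split σ j P)
... | false | false = cong suc (slice-split σ j P)
... | true  | false = trans (+-suc _ _) (cong suc (slice-split σ j P))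
... | false | true  = trans (+-suc _ _) (cong suc (slice-split σ j P))

2^-double : ∀ m → 2 ^ m + 2 ^ m ≡ 2 ^ suc m
2^-double m = cong (2 ^ m +_) (sym (+-identityʳ (2 ^ m)))

packing-size : ∀ n (P : List (Cube n)) → IsPacking P → length P ≤ 2 ^ n
packing-size zero    []          _                      = z≤n
packing-size zero    (_ ∷ [])    _                      = s≤s z≤n
packing-size zero    (_ ∷ _ ∷ _) (((() , _) ∷ _) ∷ _)
packing-size (suc m) P           packing                = begin
  length P
    ≡⟨ sym (slice-split σ zero P) ⟩
  length (slice σ zero P) + length (slice (λ s → not (σ s)) zero P)
    ≤⟨ +-mono-≤ (packing-size m _ (slice-packing _ zero P packing))
                (packing-size m _ (slice-packing _ zero P packing)) ⟩
  2 ^ m + 2 ^ m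
    ≡⟨ 2^-double m ⟩
  2 ^ suc m
    ∎
  where
  open ≤-Reasoning
  σ : Valuation
  σ _ = false

-- Every slice of a tiling of dimension m+1 has exactly 2^m cubes: both
-- complementary slices are bounded by 2^m and together they have 2^m + 2^m.
tiling-slice-size : ∀ m σ (j : Fin (suc m)) (P : List (Cube (suc m))) → IsTiling (suc m) P →
  length (slice σ j P) ≡ 2 ^ m
tiling-slice-size m σ j P (packing , |P|≡2^n) = ≤-antisym (bound σ) (+-cancelʳ-≤ (2 ^ m) _ _ (begin
  2 ^ m + 2 ^ m                        ≡⟨ 2^-double m ⟩
  2 ^ suc m                            ≡⟨ sym |P|≡2^n ⟩
  length P                             ≡⟨ sym (slice-split σ j P) ⟩
  length (slice σ j P) + length (slice (λ s → not (σ s)) j P)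
                                       ≤⟨ +-monoʳ-≤ (length (slice σ j P)) (bound _) ⟩
  length (slice σ j P) + 2 ^ m         ∎))
  where
  open ≤-Reasoning
  bound : ∀ τ → length (slice τ j P) ≤ 2 ^ m
  bound τ = packing-size m _ (slice-packing τ j P packing)

raise : Valuation → ℕ → Valuation
raise σ t s with s ≟ t
... | yes _ = true
... | no  _ = σ s

-- Raising σ at t (where σ chose t) removes from the slice exactly the cubes
-- with z_j = t and adds exactly those with z_j = t+1.
slice-raise : ∀ {m} σ (j : Fin (suc m)) t (P : List (Cube (suc m))) → σ t ≡ false →
  length (slice σ j P) + countEntry j t true P
    ≡ length (slice (raise σ t) j P) + countEntry j t false P
slice-raise σ j t []      σt≡false = refl
slice-raise σ j t (z ∷ P) σt≡false
  with proj₁ (z j) ≟ t | proj₂ (z j) ≟ᴮ true | proj₂ (z j) ≟ᴮ false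
     | slice-raise σ j t P σt≡false
... | _       | yes b≡true | yes b≡false | _  = ⊥-elim (not-¬ b≡true b≡false)
... | _       | no  b≢true | no  b≢false | _  = ⊥-elim (b≢false (¬-not b≢true))
... | yes s≡t | yes b≡true | no  _       | ih rewrite s≡t | b≡true | σt≡false =
  trans (+-suc _ _) (cong suc ih)
... | yes s≡t | no  _      | yes b≡false | ih rewrite s≡t | b≡false | σt≡false =
  trans (cong suc ih) (sym (+-suc _ _))
... | no  _   | _          | _           | ih with contains σ (z j)
...   | true  = cong suc ih
...   | false = ih

-- Part (ii): compare the slices of a tiling for the constant valuation
-- choosing every t and for its raise at t; both have 2^m cubes.
tiling-balanced : (n : ℕ) (P : List (Cube n)) → IsTiling n P →
  (j : Fin n) (t : ℕ) → countEntry j t false P ≡ countEntry j t true P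
tiling-balanced (suc m) P tiling j t =
  sym (+-cancelˡ-≡ (2 ^ m) _ _ (begin
    2 ^ m + countEntry j t true P                          ≡⟨ cong (_+ countEntry j t true P) (sym (full σ)) ⟩
    length (slice σ j P) + countEntry j t true P           ≡⟨ slice-raise σ j t P refl ⟩
    length (slice (raise σ t) j P) + countEntry j t false P ≡⟨ cong (_+ countEntry j t false P) (full (raise σ t)) ⟩
    2 ^ m + countEntry j t false P                         ∎))
  where
  open ≡-Reasoning
  σ : Valuation
  σ _ = false
  full : ∀ τ → length (slice τ j P) ≡ 2 ^ m
  full τ = tiling-slice-size m τ j P tiling

proposition10 :
    ((n : ℕ) (P : List (Cube n)) → IsNonExtensible n P → n + 1 ≤ length P)
    × ((n : ℕ) (P : List (Cube n)) → IsTiling n P →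
         (j : Fin n) (t : ℕ) → countEntry j t false P ≡ countEntry j t true P)
proposition10 = nonExtensible-size , tiling-balanced
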